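{- Let $G$ be a graph, $(T,\chi)$ a lenient tree decomposition of $G$ with $|V(T)|\ge3$, and $S\subseteq V(G)$ a set inducing a connected subgraph. For any three nodes $t,t',t''$ of $T$ such that $t'$ is an internal vertex of the unique $t$–$t''$ path in $T$: if $\chi(t)\cap S\ne\emptyset$ and $\chi(t'')\cap S\ne\emptyset$, then $\chi(t')\cap S\ne\emptyset$.
   Context: Lenient tree decomposition: $(T,\chi)$, $T$ a tree, $\chi:V(T)\to 2^{V(G)}$, with (C1) bags covering $V(G)$; (C2) every edge $e$ of $G$ satisfies $e\subseteq\chi(t)\cup\chi(t')$ for some close nodes $t,t'$ (equal or adjacent); (C3) $\{t:x\in\chi(t)\}$ is connected in $T$ for every $x$. -}

module Defs where

open import Level using (0ℓ)
open import Data.Nat using (ℕ; _≤_)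
open import Data.Fin using (Fin)
open import Data.List using (List; []; _∷_; length)
open import Data.List.Relation.Unary.Linked using (Linked)
open import Data.List.Relation.Unary.Unique.Propositional using (Unique)
open import Data.List.Membership.Propositional using (_∈_)
open import Data.Product using (Σ; ∃; _×_)
open import Data.Sum using (_⊎_)
open import Data.Empty using (⊥)
open import Relation.Nullary using (¬_)
open import Relation.Binary.PropositionalEquality using (_≡_; _≢_)

record Graph : Set₁ where
  field
    n    : ℕ
    E    : Fin n → Fin n → Set
    sym  : ∀ {x y} → E x y → E y x
    irr  : ∀ {x} → ¬ E x x

  V : Set
  V = Fin n

VSet : Graph → Set₁
VSet G = Graph.V G → Set

data WalkIn (G : Graph) (P : VSet G) : Graph.V G → Graph.V G → Set where
  here : ∀ {x} → P x → WalkIn G P x x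
  step : ∀ {x y z} → P x → Graph.E G x y → WalkIn G P y z → WalkIn G P x z

ConnectedSet : (G : Graph) → VSet G → Set
ConnectedSet G P = ∀ x y → P x → P y → WalkIn G P x y

Connected : Graph → Set
Connected G = ConnectedSet G (λ _ → Data.Unit.⊤)
  where import Data.Unit

lastOr : {A : Set} → A → List A → A
lastOr x []       = x
lastOr _ (y ∷ ys) = lastOr y ys

IsCycle : (G : Graph) → List (Graph.V G) → Set
IsCycle G []       = ⊥
IsCycle G (x ∷ xs) =
  3 ≤ length (x ∷ xs) × Unique (x ∷ xs) × Linked (Graph.E G) (x ∷ xs)
  × Graph.E G (lastOr x xs) x

Acyclic : Graph → Set
Acyclic G = ∀ vs → ¬ IsCycle G vs

IsTree : Graph → Set
IsTree T = Connected T × Acyclic T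

IsPath : (G : Graph) → Graph.V G → Graph.V G → List (Graph.V G) → Set
IsPath G s t []       = ⊥
IsPath G s t (x ∷ xs) =
  x ≡ s × lastOr x xs ≡ t × Unique (x ∷ xs) × Linked (Graph.E G) (x ∷ xs)

InternalOf : {A : Set} → A → A → A → List A → Set
InternalOf u s t vs = u ∈ vs × u ≢ s × u ≢ t

-- t' is an internal vertex of the (unique, in a tree) t–t'' path.
OnPathInternal : (T : Graph) → (t t' t'' : Graph.V T) → Set
OnPathInternal T t t' t'' =
  Σ (List (Graph.V T)) λ vs → IsPath T t t'' vs × InternalOf t' t t'' vs

Close : (T : Graph) → Graph.V T → Graph.V T → Set
Close T t t' = t ≡ t' ⊎ Graph.E T t t'

record IsLenientTD (G : Graph) (T : Graph) (χ : Graph.V T → VSet G) : Set where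
  field
    tree : IsTree T
    C1   : ∀ (x : Graph.V G) → ∃ λ t → χ t x
    C2   : ∀ (x y : Graph.V G) → Graph.E G x y →
             Σ (Graph.V T) λ t → Σ (Graph.V T) λ t' → Close T t t' ×
               ((χ t x ⊎ χ t' x) × (χ t y ⊎ χ t' y))
    C3   : ∀ (x : Graph.V G) → ConnectedSet T (λ t → χ t x)

Meets : (G : Graph) → VSet G → VSet G → Set
Meets G A S = ∃ λ x → A x × S x

-- Bags meeting S are connected in T: walk along a path of G[S] and jump, at each edge,
-- between two close bags containing its ends, using (C3) to move inside the bags of a
-- single vertex. Hence a T-walk from t to t'' through bags meeting S exists; if it
-- avoided t', shortcutting it and closing it up with the path edges at t' would give a
-- cycle in T.
module Submission where

open import Defs
open import Data.Nat using (_≤_; s≤s; z≤n)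
open import Data.Fin.Properties using (_≟_)
open import Data.List using (List; []; _∷_)
open import Data.List.Relation.Unary.Linked using (Linked; [-]; _∷_)
open import Data.List.Relation.Unary.AllPairs using ([]; _∷_)
open import Data.List.Relation.Unary.All as All using (All; []; _∷_)
open import Data.List.Relation.Unary.All.Properties using (¬Any⇒All¬)
open import Data.List.Relation.Unary.Any using (here; there)
open import Data.List.Relation.Unary.Unique.Propositional using (Unique)
open import Data.List.Membership.Propositional using (_∈_)
open import Data.Product using (Σ-syntax; _×_; _,_; proj₂)
open import Data.Sum using (_⊎_; inj₁; inj₂)
open import Data.Empty using (⊥-elim)
open import Relation.Nullary using (¬_; yes; no)
open import Relation.Binary.PropositionalEquality using (_≡_; _≢_; refl; sym; subst; ≢-sym)

module Walks (G : Graph) where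
  open Graph G using (V; E)
  open import Data.List.Membership.DecPropositional (_≟_ {Graph.n G}) using (_∈?_)

  walk-source : ∀ {P : VSet G} {x y} → WalkIn G P x y → P x
  walk-source (here p)     = p
  walk-source (step p _ _) = p

  walk-++ : ∀ {P : VSet G} {x y z} → WalkIn G P x y → WalkIn G P y z → WalkIn G P x z
  walk-++ (here _)     w′ = w′
  walk-++ (step p e w) w′ = step p e (walk-++ w w′)

  walk-reverse : ∀ {P : VSet G} {x y} → WalkIn G P x y → WalkIn G P y x
  walk-reverse (here p)     = here p
  walk-reverse (step p e w) = walk-++ (walk-reverse w) (step (walk-source w) (Graph.sym G e) (here p))

  walk-map : ∀ {P Q : VSet G} {x y} → (∀ v → P v → Q v) → WalkIn G P x y → WalkIn G Q x y
  walk-map f (here p)     = here (f _ p)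
  walk-map f (step p e w) = step (f _ p) e (walk-map f w)

  hit-or-avoid : ∀ {P : VSet G} {x y} u → WalkIn G P x y → P u ⊎ WalkIn G (_≢ u) x y
  hit-or-avoid {x = x} u (here p) with x ≟ u
  ... | yes refl = inj₁ p
  ... | no x≢u   = inj₂ (here x≢u)
  hit-or-avoid {x = x} u (step p e w) with x ≟ u | hit-or-avoid u w
  ... | yes refl | _        = inj₁ p
  ... | no _     | inj₁ q   = inj₁ q
  ... | no x≢u   | inj₂ w′  = inj₂ (step x≢u e w′)

  linked-walk : ∀ {P : VSet G} x l → Linked E (x ∷ l) → All P (x ∷ l) → WalkIn G P x (lastOr x l)
  linked-walk x []      _        (p ∷ _)  = here p
  linked-walk x (y ∷ l) (e ∷ lk) (p ∷ ps) = step p e (linked-walk y l lk ps)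

  record PathIn (P : VSet G) (x y : V) : Set where
    field
      route  : List V
      ends   : lastOr x route ≡ y
      unique : Unique (x ∷ route)
      linked : Linked E (x ∷ route)
      inside : All P (x ∷ route)
  open PathIn

  path-suffix : ∀ {P : VSet G} {v x y} (p : PathIn P v y) → x ∈ (v ∷ route p) → PathIn P x y
  path-suffix p (here refl) = p
  path-suffix record { route = w ∷ l ; ends = ends ; unique = _ ∷ uq ; linked = _ ∷ lk ; inside = _ ∷ ps }
              (there x∈) =
    path-suffix record { route = l ; ends = ends ; unique = uq ; linked = lk ; inside = ps } x∈

  walk→path : ∀ {P : VSet G} {x y} → WalkIn G P x y → PathIn P x y
  walk→path (here p) = record { route = [] ; ends = refl ; unique = [] ∷ [] ; linked = [-] ; inside = p ∷ [] }
  walk→path {x = x} (step {y = y} p e w) with walk→path w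
  ... | q with x ∈? (y ∷ route q)
  ... | yes x∈ = path-suffix q x∈
  ... | no x∉  = record
    { route  = y ∷ route q
    ; ends   = ends q
    ; unique = ¬Any⇒All¬ _ x∉ ∷ unique q
    ; linked = e ∷ linked q
    ; inside = p ∷ inside q
    }

module Forests (T : Graph) (acyclic : Acyclic T) where
  open Graph T using (V; E)
  open Walks T

  no-detour : ∀ {x u z} → E x u → E u z → x ≢ z → ¬ WalkIn T (_≢ u) z x
  no-detour {x} {u} {z} xu uz x≢z w with walk→path w
  ... | record { route = [] ; ends = refl } = x≢z refl
  ... | record { route = c ∷ l ; ends = ends ; unique = uq ; linked = lk ; inside = avoid } =
    acyclic (u ∷ z ∷ c ∷ l)
      ( s≤s (s≤s (s≤s z≤n))
      , All.map ≢-sym avoid ∷ uq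
      , uz ∷ lk
      , subst (λ v → E v u) (sym ends) xu )

  -- Induction along the path: the avoiding walk is extended backwards by one path edge
  -- until its source is the neighbour of u on the path.
  interior-separates : ∀ x l {u} → Unique (x ∷ l) → Linked E (x ∷ l) → u ∈ l → u ≢ lastOr x l →
                       ¬ WalkIn T (_≢ u) x (lastOr x l)
  interior-separates x (u ∷ []) _ _ (here refl) u≢last _ = u≢last refl
  interior-separates x (u ∷ z ∷ l) ((_ ∷ x≢z ∷ _) ∷ (u∉ ∷ _)) (xu ∷ uz ∷ lk) (here refl) _ w =
    no-detour xu uz x≢z (walk-++ (linked-walk z l lk (All.map ≢-sym u∉)) (walk-reverse w))
  interior-separates x (y ∷ l) (_ ∷ uq@(y∉ ∷ _)) (xy ∷ lk) (there u∈) u≢last w =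
    interior-separates y l uq lk u∈ u≢last (step (All.lookup y∉ u∈) (Graph.sym T xy) w)

  internal-vertex-separates : ∀ {t u t″} → OnPathInternal T t u t″ → ¬ WalkIn T (_≢ u) t t″
  internal-vertex-separates ([] , () , _)
  internal-vertex-separates (x ∷ l , (refl , refl , _ , _) , here refl , u≢t , _) _ = u≢t refl
  internal-vertex-separates (x ∷ l , (refl , refl , uq , lk) , there u∈ , _ , u≢t″) =
    interior-separates x l uq lk u∈ u≢t″

module LenientTD {G T : Graph} {χ : Graph.V T → VSet G} (td : IsLenientTD G T χ) where
  open IsLenientTD td
  open Walks T using (walk-++; walk-map)

  close-sym : ∀ {p q} → Close T p q → Close T q p
  close-sym (inj₁ refl) = inj₁ refl
  close-sym (inj₂ e)    = inj₂ (Graph.sym T e)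

  close-bags : ∀ {x y} → Graph.E G x y → Σ[ p ∈ Graph.V T ] Σ[ q ∈ Graph.V T ] Close T p q × χ p x × χ q y
  close-bags {x} {y} e with C2 x y e
  ... | p , q , pq , inj₁ px , inj₁ py = p , p , inj₁ refl , px , py
  ... | p , q , pq , inj₁ px , inj₂ qy = p , q , pq , px , qy
  ... | p , q , pq , inj₂ qx , inj₁ py = q , p , close-sym pq , qx , py
  ... | p , q , pq , inj₂ qx , inj₂ qy = q , q , inj₁ refl , qx , qy

  module _ {S : VSet G} where
    MeetsS : VSet T
    MeetsS t = Meets G (χ t) S

    bags-of-vertex-connected : ∀ {x} → S x → ∀ {a b} → χ a x → χ b x → WalkIn T MeetsS a b
    bags-of-vertex-connected {x} sx {a} {b} ax bx = walk-map (λ _ tx → x , tx , sx) (C3 x a b ax bx)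

    bag-walk : ∀ {x y} → WalkIn G S x y → ∀ {a b} → χ a x → χ b y → WalkIn T MeetsS a b
    bag-walk (here sx) ax by = bags-of-vertex-connected sx ax by
    bag-walk (step sx e w) ax by with close-bags e
    ... | p , q , pq , px , qy = walk-++ (bags-of-vertex-connected sx ax px) (cross pq)
      where
      rest = bag-walk w qy by
      cross : Close T p q → WalkIn T MeetsS p _
      cross (inj₁ refl) = rest
      cross (inj₂ pq)   = step (_ , px , sx) pq rest

    bags-meeting-connected : ConnectedSet G S → ConnectedSet T MeetsS
    bags-meeting-connected conn a b (x , ax , sx) (y , by , sy) = bag-walk (conn x y sx sy) ax by

mainTheorem14 : (G T : Graph) (χ : Graph.V T → VSet G) →
    IsLenientTD G T χ → 3 ≤ Graph.n T →
    (S : VSet G) → ConnectedSet G S →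
    (t t' t'' : Graph.V T) → OnPathInternal T t t' t'' →
    Meets G (χ t) S → Meets G (χ t'') S → Meets G (χ t') S
mainTheorem14 G T χ td _ S conn t t' t'' t'-internal t-meets t''-meets
  with Walks.hit-or-avoid T t' (LenientTD.bags-meeting-connected td conn t t'' t-meets t''-meets)
... | inj₁ t'-meets = t'-meets
... | inj₂ avoiding = ⊥-elim (Forests.internal-vertex-separates T (proj₂ (IsLenientTD.tree td)) t'-internal avoiding)
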